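{- Let $j\ge 3$ and let $\alpha=\alpha_1\cdots\alpha_j$ and $\beta=\beta_1\cdots\beta_j$ be permutations in $S_j$ such that $\alpha_1=\beta_1=1$, $\alpha_j=\beta_j$, $\mathrm{des}(\alpha)=\mathrm{des}(\beta)$, and both $\alpha$ and $\beta$ have the minimal overlapping property. Then \[ \sum_{n\ge 0}\frac{t^n}{n!}\sum_{\sigma\in\mathcal{NM}_n(\alpha)} x^{\mathrm{des}(\sigma)}=\sum_{n\ge 0}\frac{t^n}{n!}\sum_{\sigma\in\mathcal{NM}_n(\beta)} x^{\mathrm{des}(\sigma)}, \] i.e. $\alpha$ and $\beta$ are $\mathrm{des}$-c-Wilf equivalent. If in addition $\mathrm{inv}(\alpha)=\mathrm{inv}(\beta)$, then \[ \sum_{n\ge 0}\frac{t^n}{[n]_q!}\sum_{\sigma\in\mathcal{NM}_n(\alpha)} x^{\mathrm{des}(\sigma)}q^{\mathrm{inv}(\sigma)}=\sum_{n\ge 0}\frac{t^n}{[n]_q!}\sum_{\sigma\in\mathcal{NM}_n(\beta)} x^{\mathrm{des}(\sigma)}q^{\mathrm{inv}(\sigma)}, \] i.e. $\alpha$ and $\beta$ are $(\mathrm{des},\mathrm{inv})$-c-Wilf equivalent.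
   Context: $S_n$ is the set of permutations $\sigma=\sigma_1\cdots\sigma_n$ of $\{1,\dots,n\}$. $\mathrm{des}(\sigma)=|\{i:\sigma_i>\sigma_{i+1}\}|$ and $\mathrm{inv}(\sigma)=|\{(i,k):i<k,\ \sigma_i>\sigma_k\}|$. For a sequence $w$ of distinct positive integers, $\mathrm{red}(w)$ is the permutation obtained by replacing the $i$-th smallest entry by $i$. For $\tau\in S_j$ and $\sigma\in S_n$, $\sigma$ has a $\tau$-match starting at position $i$ if $\mathrm{red}(\sigma_i\sigma_{i+1}\cdots\sigma_{i+j-1})=\tau$; $\tau\text{ - }\mathrm{mch}(\sigma)$ is the number of $\tau$-matches in $\sigma$, and $\mathcal{NM}_n(\tau)$ is the set of $\sigma\in S_n$ with no $\tau$-match. A permutation $\tau\in S_j$, $j\ge3$, has the minimal overlapping property if the smallest $i$ for which some $\sigma\in S_i$ has $\tau\text{ - }\mathrm{mch}(\sigma)=2$ is $i=2j-1$ (so two $\tau$-matches in any permutation share at most one letter). $[n]_q=1+q+\cdots+q^{n-1}$, $[n]_q!=[1]_q[2]_q\cdots[n]_q$, $[0]_q!=1$. -}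

module Defs where

open import Data.Nat using (ℕ; zero; suc; _+_; _∸_; _≤_; _<ᵇ_; _≡ᵇ_; _≤ᵇ_; _*_)
open import Data.Nat.Properties using (_≟_)
open import Data.Bool using (Bool; true; false; if_then_else_; not; _∧_)
open import Data.List using (List; []; _∷_; map; concatMap; upTo; length; take; drop)
open import Data.Bool.ListAction using (any)
open import Data.List.Properties using (≡-dec)
open import Data.List.Membership.Propositional using (_∈_)
open import Relation.Nullary.Decidable using (⌊_⌋)
open import Relation.Binary.PropositionalEquality using (_≡_; _≢_)
open import Data.Product using (Σ; _×_)

countᵇ : {A : Set} → (A → Bool) → List A → ℕ
countᵇ p [] = 0
countᵇ p (x ∷ xs) = (if p x then 1 else 0) + countᵇ p xs

words : ℕ → ℕ → List (List ℕ)
words zero n = [] ∷ []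
words (suc l) n = concatMap (λ a → map (a ∷_) (words l n)) (map suc (upTo n))

distinctᵇ : List ℕ → Bool
distinctᵇ [] = true
distinctᵇ (x ∷ xs) = not (any (x ≡ᵇ_) xs) ∧ distinctᵇ xs

filterᵇ : {A : Set} → (A → Bool) → List A → List A
filterᵇ p [] = []
filterᵇ p (x ∷ xs) = if p x then x ∷ filterᵇ p xs else filterᵇ p xs

S : ℕ → List (List ℕ)
S n = filterᵇ distinctᵇ (words n n)

des : List ℕ → ℕ
des (x ∷ y ∷ xs) = (if y <ᵇ x then 1 else 0) + des (y ∷ xs)
des _ = 0

inv : List ℕ → ℕ
inv [] = 0
inv (x ∷ xs) = countᵇ (λ y → y <ᵇ x) xs + inv xs

-- red(w): replace the i-th smallest entry by i (w with distinct entries)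
red : List ℕ → List ℕ
red w = map (λ a → suc (countᵇ (λ b → b <ᵇ a) w)) w

eqListᵇ : List ℕ → List ℕ → Bool
eqListᵇ u v = ⌊ ≡-dec _≟_ u v ⌋

-- σ has a τ-match starting at (0-based) position i, j = length τ, i + j ≤ n
matchAtᵇ : List ℕ → List ℕ → ℕ → Bool
matchAtᵇ τ σ i = eqListᵇ (red (take (length τ) (drop i σ))) τ

positions : ℕ → ℕ → List ℕ
positions j n = if j ≤ᵇ n then upTo (suc (n ∸ j)) else []

mch : List ℕ → List ℕ → ℕ
mch τ σ = countᵇ (matchAtᵇ τ σ) (positions (length τ) (length σ))

NM : ℕ → List ℕ → List (List ℕ)
NM n τ = filterᵇ (λ σ → mch τ σ ≡ᵇ 0) (S n)

MinimalOverlapping : List ℕ → Set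
MinimalOverlapping τ =
  3 ≤ length τ ×
  Σ (List ℕ) (λ σ → σ ∈ S (2 * length τ ∸ 1) × mch τ σ ≡ 2) ×
  (∀ i → suc i ≤ 2 * length τ ∸ 1 → ∀ σ → σ ∈ S i → mch τ σ ≢ 2)

-- coefficient of t^n/n! x^k in Σ_n t^n/n! Σ_{σ∈NM_n(τ)} x^des(σ)
desCoeff : List ℕ → ℕ → ℕ → ℕ
desCoeff τ n k = countᵇ (λ σ → des σ ≡ᵇ k) (NM n τ)

-- coefficient of t^n/[n]_q! x^k q^m in Σ_n t^n/[n]_q! Σ_{σ∈NM_n(τ)} x^des(σ) q^inv(σ)
desInvCoeff : List ℕ → ℕ → ℕ → ℕ → ℕ
desInvCoeff τ n k m = countᵇ (λ σ → (des σ ≡ᵇ k) ∧ (inv σ ≡ᵇ m)) (NM n τ)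

DesCWilfEquiv : List ℕ → List ℕ → Set
DesCWilfEquiv α β = ∀ n k → desCoeff α n k ≡ desCoeff β n k

DesInvCWilfEquiv : List ℕ → List ℕ → Set
DesInvCWilfEquiv α β = ∀ n k m → desInvCoeff α n k m ≡ desInvCoeff β n k m

module Submission where

-- Proof (cluster method, without signs).  Fix n and a predicate P on permutations depending only on des
-- (and on inv).  For a set M of window positions let c_γ(M) = #{σ ∈ S_n : P σ, σ has a γ-match at every
-- position of M}.  Inclusion–exclusion for each σ, summed over σ with the two sums exchanged, gives
--     #{σ ∈ NM_n(γ) : P σ} + Σ_{|M| odd} c_γ(M) = Σ_{|M| even} c_γ(M),
-- so it suffices that c_α(M) = c_β(M) for all M.  If two positions of M are closer than j − 1, the
-- minimal overlapping property makes both counts 0.  Otherwise consecutive windows share at most one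
-- letter, and rearranging the first j − 1 letters of each α-window into the pattern β is a bijection
-- (first and last letters of the windows stay put) which preserves des, and inv when inv α = inv β.

open import Defs
open import Data.Nat using (ℕ; zero; suc; _+_; _∸_; _*_; _≤_; _<_; _<ᵇ_; _≡ᵇ_; _≤ᵇ_; z≤n; s≤s)
open import Data.Nat.Properties using (suc-injective; +-assoc; +-comm; +-suc; +-identityʳ; +-cancelʳ-≡; +-cancelˡ-<;
  ≤-refl; ≤-trans; ≤-reflexive; <-trans; <-≤-trans; <-cmp; <-irrefl; <⇒≤; <⇒≱; ≰⇒>; +-mono-≤; +-monoʳ-≤;
  m≤n+m; m+n≤o⇒m≤o∸n; m+n∸n≡m; m∸n+n≡m; m+[n∸m]≡n; m≤n⇒m⊓n≡m; m≤n⇒∃[o]m+o≡n;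
  ≡ᵇ⇒≡; ≡⇒≡ᵇ; <ᵇ⇒<; <⇒<ᵇ; ≤ᵇ⇒≤; ≤⇒≤ᵇ)
open import Data.Nat.ListAction using (sum)
open import Data.Nat.ListAction.Properties using (sum-↭)
open import Data.Nat.Tactic.RingSolver using (solve-∀)
open import Data.Bool using (Bool; true; false; T; not; _∧_; if_then_else_)
open import Data.Bool.Properties using (T-≡; ∧-zeroʳ; ∧-identityʳ; not-involutive)
open import Data.Bool.ListAction using (any; all)
open import Data.List using (List; []; _∷_; _++_; map; length; take; drop; head; last; upTo; applyUpTo;
  concatMap; cartesianProductWith)
open import Data.List.Properties using (length-map; length-++; length-upTo; length-take; length-drop; ∷-injective;
  ++-assoc; ++-identityʳ; map-∘; map-++; map-cong-local; map-id-local; take-map; drop-map; drop-drop; take-take;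
  map-upTo; upTo-∷ʳ)
open import Data.List.Membership.Propositional using (_∈_; _∉_)
open import Data.List.Membership.Propositional.Properties using (∈-map⁺; ∈-map⁻; ∈-++⁻; ∈-∃++; ∈-upTo⁺; ∈-upTo⁻;
  ∈-cartesianProductWith⁺; ∈-cartesianProductWith⁻)
open import Data.List.Membership.Propositional.Properties.WithK using (unique∧set⇒bag)
open import Data.List.Relation.Unary.Any using (here; there)
open import Data.List.Relation.Unary.All using (All; []; _∷_; tabulate; lookup)
open import Data.List.Relation.Unary.All.Properties using (¬Any⇒All¬; All¬⇒¬Any)
open import Data.List.Relation.Unary.AllPairs using (AllPairs; []; _∷_)
open import Data.List.Relation.Unary.AllPairs.Properties using (applyUpTo⁺₁)
open import Data.List.Relation.Unary.Unique.Propositional using (Unique)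
import Data.List.Relation.Unary.Unique.Propositional.Properties as Unique
open import Data.List.Relation.Binary.Permutation.Propositional as ↭ using (_↭_; ↭-sym; ↭-trans; ↭⇒↭ₛ)
open import Data.List.Relation.Binary.Permutation.Propositional.Properties using (↭-length; ∈-resp-↭; All-resp-↭;
  shift; drop-mid; ++⁺ˡ; ++⁺ʳ; ++⁺; map⁺)
open import Data.List.Relation.Binary.Permutation.Setoid.Properties using (Unique-resp-↭)
open import Data.List.Relation.Binary.BagAndSetEquality using (∼bag⇒↭)
open import Data.Maybe using (just)
open import Data.Maybe.Properties using (just-injective)
open import Data.Product using (Σ; _×_; _,_; proj₁; proj₂)
open import Data.Sum using (inj₁; inj₂)
open import Data.Unit using (⊤; tt)
open import Data.Empty using (⊥; ⊥-elim)
open import Function using (_∘_)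
open import Function.Bundles using (Equivalence; mk⇔)
open import Relation.Binary.Definitions using (tri<; tri≈; tri>)
open import Relation.Binary.PropositionalEquality using (_≡_; refl; cong; cong₂; sym; trans; subst; subst₂;
  setoid; module ≡-Reasoning)
open import Relation.Nullary.Decidable using (toWitness; fromWitness)

bit : Bool → ℕ
bit b = if b then 1 else 0

count-++ : {A : Set} (p : A → Bool) (xs ys : List A) →
  countᵇ p (xs ++ ys) ≡ countᵇ p xs + countᵇ p ys
count-++ p [] ys = refl
count-++ p (x ∷ xs) ys = trans (cong (bit (p x) +_) (count-++ p xs ys)) (sym (+-assoc (bit (p x)) _ _))

count-sum : {A : Set} (p : A → Bool) (xs : List A) → countᵇ p xs ≡ sum (map (bit ∘ p) xs)
count-sum p [] = refl
count-sum p (x ∷ xs) = cong (bit (p x) +_) (count-sum p xs)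

count-↭ : {A : Set} (p : A → Bool) {xs ys : List A} → xs ↭ ys → countᵇ p xs ≡ countᵇ p ys
count-↭ p {xs} {ys} q = trans (count-sum p xs) (trans (sum-↭ (map⁺ (bit ∘ p) q)) (sym (count-sum p ys)))

count-cong : {A : Set} (p q : A → Bool) (xs : List A) → (∀ x → x ∈ xs → p x ≡ q x) → countᵇ p xs ≡ countᵇ q xs
count-cong p q [] h = refl
count-cong p q (x ∷ xs) h = cong₂ (λ a c → bit a + c) (h x (here refl)) (count-cong p q xs (λ y m → h y (there m)))

count-none : {A : Set} (p : A → Bool) (xs : List A) → (∀ x → x ∈ xs → p x ≡ false) → countᵇ p xs ≡ 0
count-none p [] h = refl
count-none p (x ∷ xs) h rewrite h x (here refl) = count-none p xs (λ y m → h y (there m))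

count-all : {A : Set} (p : A → Bool) (xs : List A) → (∀ x → x ∈ xs → p x ≡ true) → countᵇ p xs ≡ length xs
count-all p [] h = refl
count-all p (x ∷ xs) h rewrite h x (here refl) = cong suc (count-all p xs (λ y m → h y (there m)))

count-map : {A B : Set} (p : B → Bool) (f : A → B) (xs : List A) → countᵇ p (map f xs) ≡ countᵇ (p ∘ f) xs
count-map p f [] = refl
count-map p f (x ∷ xs) = cong (bit (p (f x)) +_) (count-map p f xs)

count-filter : {A : Set} (p q : A → Bool) (xs : List A) → countᵇ p (filterᵇ q xs) ≡ countᵇ (λ x → q x ∧ p x) xs
count-filter p q [] = refl
count-filter p q (x ∷ xs) with q x
... | true = cong (bit (p x) +_) (count-filter p q xs)
... | false = count-filter p q xs

length-filter : {A : Set} (p : A → Bool) (xs : List A) → length (filterᵇ p xs) ≡ countᵇ p xs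
length-filter p [] = refl
length-filter p (x ∷ xs) with p x
... | true = cong suc (length-filter p xs)
... | false = length-filter p xs

count-guard : {A : Set} (b : Bool) (f : A → Bool) (xs : List A) →
  countᵇ (λ x → b ∧ f x) xs ≡ (if b then countᵇ f xs else 0)
count-guard true f xs = refl
count-guard false f xs = count-none _ xs (λ _ _ → refl)

count-mono : {A : Set} (p q : A → Bool) (xs : List A) → (∀ x → x ∈ xs → p x ≡ true → q x ≡ true) →
  countᵇ p xs ≤ countᵇ q xs
count-mono p q [] h = z≤n
count-mono p q (x ∷ xs) h with p x in e
... | true rewrite h x (here refl) e = s≤s (count-mono p q xs (λ y m → h y (there m)))
... | false = ≤-trans (count-mono p q xs (λ y m → h y (there m))) (m≤n+m _ (bit (q x)))

count-strict : {A : Set} (p q : A → Bool) (xs : List A) → (∀ x → x ∈ xs → p x ≡ true → q x ≡ true) →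
  (y : A) → y ∈ xs → p y ≡ false → q y ≡ true → countᵇ p xs < countᵇ q xs
count-strict p q (x ∷ xs) h y (here refl) py qy rewrite py | qy = s≤s (count-mono p q xs (λ z m → h z (there m)))
count-strict p q (x ∷ xs) h y (there my) py qy with p x in e
... | true rewrite h x (here refl) e = s≤s (count-strict p q xs (λ z m → h z (there m)) y my py qy)
... | false = <-≤-trans (count-strict p q xs (λ z m → h z (there m)) y my py qy) (m≤n+m _ (bit (q x)))

count-<-length : {A : Set} (p : A → Bool) (xs : List A) (y : A) → y ∈ xs → p y ≡ false → countᵇ p xs < length xs
count-<-length p xs y my py =
  subst (countᵇ p xs <_) (count-all (λ _ → true) xs (λ _ _ → refl)) (count-strict p (λ _ → true) xs (λ _ _ _ → refl) y my py refl)

∈-filterᵇ⁻ : {A : Set} (p : A → Bool) (xs : List A) {x : A} → x ∈ filterᵇ p xs → x ∈ xs × p x ≡ true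
∈-filterᵇ⁻ p (y ∷ xs) m with p y in eq
∈-filterᵇ⁻ p (y ∷ xs) (here refl) | true = here refl , eq
∈-filterᵇ⁻ p (y ∷ xs) (there m) | true = let (a , b) = ∈-filterᵇ⁻ p xs m in there a , b
∈-filterᵇ⁻ p (y ∷ xs) m | false = let (a , b) = ∈-filterᵇ⁻ p xs m in there a , b

∈-filterᵇ⁺ : {A : Set} (p : A → Bool) (xs : List A) {x : A} → x ∈ xs → p x ≡ true → x ∈ filterᵇ p xs
∈-filterᵇ⁺ p (y ∷ xs) (here refl) e rewrite e = here refl
∈-filterᵇ⁺ p (y ∷ xs) (there m) e with p y
... | true = there (∈-filterᵇ⁺ p xs m e)
... | false = ∈-filterᵇ⁺ p xs m e

Unique-filterᵇ : {A : Set} (p : A → Bool) (xs : List A) → Unique xs → Unique (filterᵇ p xs)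
Unique-filterᵇ p [] u = []
Unique-filterᵇ p (x ∷ xs) (x∉xs ∷ u) with p x
... | true = ¬Any⇒All¬ _ (λ m → All¬⇒¬Any x∉xs (proj₁ (∈-filterᵇ⁻ p xs m))) ∷ Unique-filterᵇ p xs u
... | false = Unique-filterᵇ p xs u

Unique-map : {A B : Set} (f : A → B) (xs : List A) → (∀ {a b} → a ∈ xs → b ∈ xs → f a ≡ f b → a ≡ b) →
  Unique xs → Unique (map f xs)
Unique-map f [] inj u = []
Unique-map f (x ∷ xs) inj (x∉xs ∷ u) = ¬Any⇒All¬ _ fx∉ ∷ Unique-map f xs (λ ma mb → inj (there ma) (there mb)) u
  where
  fx∉ : f x ∉ map f xs
  fx∉ m with ∈-map⁻ f m
  ... | y , my , e = All¬⇒¬Any x∉xs (subst (_∈ xs) (sym (inj (here refl) (there my) e)) my)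

count-bijection : {A : Set} (L₁ L₂ : List A) (P Q : A → Bool) (f g : A → A) → Unique L₁ → Unique L₂ →
  (∀ x → x ∈ L₁ → P x ≡ true → f x ∈ L₂ × Q (f x) ≡ true × g (f x) ≡ x) →
  (∀ y → y ∈ L₂ → Q y ≡ true → g y ∈ L₁ × P (g y) ≡ true × f (g y) ≡ y) →
  countᵇ P L₁ ≡ countᵇ Q L₂
count-bijection {A} L₁ L₂ P Q f g u₁ u₂ to from = begin
  countᵇ P L₁          ≡⟨ length-filter P L₁ ⟨
  length F₁            ≡⟨ length-map f F₁ ⟨
  length (map f F₁)    ≡⟨ ↭-length (∼bag⇒↭ (unique∧set⇒bag uF₁ uF₂ (mk⇔ fw bw))) ⟩
  length F₂            ≡⟨ length-filter Q L₂ ⟩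
  countᵇ Q L₂          ∎
  where
  open ≡-Reasoning
  F₁ F₂ : List A
  F₁ = filterᵇ P L₁
  F₂ = filterᵇ Q L₂
  uF₁ : Unique (map f F₁)
  uF₁ = Unique-map f F₁ inj (Unique-filterᵇ P L₁ u₁)
    where
    inj : ∀ {a b} → a ∈ F₁ → b ∈ F₁ → f a ≡ f b → a ≡ b
    inj {a} {b} ma mb e =
      let (a∈ , Pa) = ∈-filterᵇ⁻ P L₁ ma ; (b∈ , Pb) = ∈-filterᵇ⁻ P L₁ mb in
      trans (sym (proj₂ (proj₂ (to a a∈ Pa)))) (trans (cong g e) (proj₂ (proj₂ (to b b∈ Pb))))
  uF₂ : Unique F₂
  uF₂ = Unique-filterᵇ Q L₂ u₂
  fw : ∀ {y} → y ∈ map f F₁ → y ∈ F₂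
  fw m with ∈-map⁻ f m
  ... | x , mx , refl = let (x∈ , Px) = ∈-filterᵇ⁻ P L₁ mx ; (fx∈ , Qfx , _) = to x x∈ Px in ∈-filterᵇ⁺ Q L₂ fx∈ Qfx
  bw : ∀ {y} → y ∈ F₂ → y ∈ map f F₁
  bw m = let (y∈ , Qy) = ∈-filterᵇ⁻ Q L₂ m ; (gy∈ , Pgy , fgy) = from _ y∈ Qy in
    subst (_∈ map f F₁) fgy (∈-map⁺ f (∈-filterᵇ⁺ P L₁ gy∈ Pgy))

range : ℕ → List ℕ
range n = map suc (upTo n)

Unique-range : (n : ℕ) → Unique (range n)
Unique-range n = Unique.map⁺ suc-injective (Unique.upTo⁺ n)

length-range : (n : ℕ) → length (range n) ≡ n
length-range n = trans (length-map suc (upTo n)) (length-upTo n)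

-- concatMap of maps is the cartesian product, for which the library provides membership and
-- uniqueness lemmas
concatMap-map : {A B C : Set} (f : A → B → C) (xs : List A) (ys : List B) →
  concatMap (λ x → map (f x) ys) xs ≡ cartesianProductWith f xs ys
concatMap-map f [] ys = refl
concatMap-map f (x ∷ xs) ys = cong (map (f x) ys ++_) (concatMap-map f xs ys)

words-suc : (l n : ℕ) → words (suc l) n ≡ cartesianProductWith _∷_ (range n) (words l n)
words-suc l n = concatMap-map _∷_ (range n) (words l n)

Unique-words : (l n : ℕ) → Unique (words l n)
Unique-words zero n = [] ∷ []
Unique-words (suc l) n rewrite words-suc l n =
  Unique.cartesianProductWith⁺ _∷_ ∷-injective (Unique-range n) (Unique-words l n)

∈-words⁻ : (l n : ℕ) (w : List ℕ) → w ∈ words l n → length w ≡ l × All (_∈ range n) w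
∈-words⁻ zero n .[] (here refl) = refl , []
∈-words⁻ (suc l) n w m rewrite words-suc l n with ∈-cartesianProductWith⁻ _∷_ (range n) (words l n) m
... | a , v , a∈ , v∈ , refl = let (len , al) = ∈-words⁻ l n v v∈ in cong suc len , a∈ ∷ al

∈-words⁺ : (n : ℕ) (w : List ℕ) → All (_∈ range n) w → w ∈ words (length w) n
∈-words⁺ n [] al = here refl
∈-words⁺ n (a ∷ w) (a∈ ∷ al) rewrite words-suc (length w) n =
  ∈-cartesianProductWith⁺ _∷_ a∈ (∈-words⁺ n w al)

any≡ᵇ-false : (x : ℕ) (xs : List ℕ) → any (x ≡ᵇ_) xs ≡ false → x ∉ xs
any≡ᵇ-false x (y ∷ xs) e m with x ≡ᵇ y in eq
any≡ᵇ-false x (y ∷ xs) e (here refl) | false = subst T eq (≡⇒≡ᵇ x x refl)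
any≡ᵇ-false x (y ∷ xs) e (there m) | false = any≡ᵇ-false x xs e m

∉⇒any≡ᵇ-false : (x : ℕ) (xs : List ℕ) → x ∉ xs → any (x ≡ᵇ_) xs ≡ false
∉⇒any≡ᵇ-false x [] h = refl
∉⇒any≡ᵇ-false x (y ∷ xs) h with x ≡ᵇ y in eq
... | true = ⊥-elim (h (here (≡ᵇ⇒≡ x y (subst T (sym eq) _))))
... | false = ∉⇒any≡ᵇ-false x xs (λ m → h (there m))

distinctᵇ⇒Unique : (w : List ℕ) → distinctᵇ w ≡ true → Unique w
distinctᵇ⇒Unique [] e = []
distinctᵇ⇒Unique (x ∷ xs) e with any (x ≡ᵇ_) xs in eq
... | false = ¬Any⇒All¬ xs (any≡ᵇ-false x xs eq) ∷ distinctᵇ⇒Unique xs e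

Unique⇒distinctᵇ : (w : List ℕ) → Unique w → distinctᵇ w ≡ true
Unique⇒distinctᵇ [] u = refl
Unique⇒distinctᵇ (x ∷ xs) (x∉xs ∷ u) rewrite ∉⇒any≡ᵇ-false x xs (All¬⇒¬Any x∉xs) = Unique⇒distinctᵇ xs u

IsPerm : ℕ → List ℕ → Set
IsPerm n w = length w ≡ n × All (_∈ range n) w × Unique w

∈S⁻ : (n : ℕ) (w : List ℕ) → w ∈ S n → IsPerm n w
∈S⁻ n w m =
  let (w∈ , d) = ∈-filterᵇ⁻ distinctᵇ (words n n) m ; (len , al) = ∈-words⁻ n n w w∈ in
  len , al , distinctᵇ⇒Unique w d

∈S⁺ : (n : ℕ) (w : List ℕ) → IsPerm n w → w ∈ S n
∈S⁺ n w (refl , al , u) = ∈-filterᵇ⁺ distinctᵇ (words (length w) (length w)) (∈-words⁺ (length w) w al) (Unique⇒distinctᵇ w u)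

Unique-S : (n : ℕ) → Unique (S n)
Unique-S n = Unique-filterᵇ distinctᵇ (words n n) (Unique-words n n)

Unique-resp : {xs ys : List ℕ} → xs ↭ ys → Unique xs → Unique ys
Unique-resp p = Unique-resp-↭ (setoid ℕ) (↭⇒↭ₛ p)

S-resp-↭ : (n : ℕ) {v w : List ℕ} → v ↭ w → v ∈ S n → w ∈ S n
S-resp-↭ n {v} {w} p m = let (len , al , u) = ∈S⁻ n v m in
  ∈S⁺ n w (trans (sym (↭-length p)) len , All-resp-↭ p al , Unique-resp p u)

Unique-⊆-length⇒↭ : {A : Set} (xs ys : List A) → Unique xs → (∀ {x} → x ∈ xs → x ∈ ys) →
  length xs ≡ length ys → xs ↭ ys
Unique-⊆-length⇒↭ [] [] u sub len = ↭.refl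
Unique-⊆-length⇒↭ (x ∷ xs) ys (x∉xs ∷ u) sub len with ∈-∃++ (sub (here refl))
... | us , vs , refl = ↭-sym (↭.trans (shift x us vs) (↭.prep x (↭-sym xs↭us++vs)))
  where
  sub' : ∀ {z} → z ∈ xs → z ∈ us ++ vs
  sub' m with ∈-resp-↭ (shift x us vs) (sub (there m))
  ... | here refl = ⊥-elim (All¬⇒¬Any x∉xs m)
  ... | there m' = m'
  xs↭us++vs : xs ↭ us ++ vs
  xs↭us++vs = Unique-⊆-length⇒↭ xs (us ++ vs) u sub' (suc-injective (trans len (↭-length (shift x us vs))))

S↭range : (n : ℕ) (w : List ℕ) → w ∈ S n → w ↭ range n
S↭range n w m = let (len , al , u) = ∈S⁻ n w m in
  Unique-⊆-length⇒↭ w (range n) u (lookup al) (trans len (sym (length-range n)))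

T⇒≡true : ∀ {b} → T b → b ≡ true
T⇒≡true = Equivalence.to T-≡

≡true⇒T : ∀ {b} → b ≡ true → T b
≡true⇒T = Equivalence.from T-≡

<ᵇ-≡ : ∀ {m n m′ n′} → (m < n → m′ < n′) → (m′ < n′ → m < n) → (m <ᵇ n) ≡ (m′ <ᵇ n′)
<ᵇ-≡ {m} {n} {m′} {n′} to from with m <ᵇ n in e | m′ <ᵇ n′ in e′
... | true  | true  = refl
... | false | false = refl
... | true  | false = ⊥-elim (subst T e′ (<⇒<ᵇ (to (<ᵇ⇒< m n (≡true⇒T e)))))
... | false | true  = ⊥-elim (subst T e (<⇒<ᵇ (from (<ᵇ⇒< m′ n′ (≡true⇒T e′)))))

<ᵇ-irrefl : (a : ℕ) → (a <ᵇ a) ≡ false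
<ᵇ-irrefl zero = refl
<ᵇ-irrefl (suc a) = <ᵇ-irrefl a

rank : List ℕ → ℕ → ℕ
rank w a = countᵇ (λ b → b <ᵇ a) w

rank-< : (w : List ℕ) {a b : ℕ} → a ∈ w → a < b → rank w a < rank w b
rank-< w {a} {b} a∈ a<b = count-strict _ _ w c<b a a∈ (<ᵇ-irrefl a) (T⇒≡true (<⇒<ᵇ a<b))
  where
  c<b : ∀ c → c ∈ w → (c <ᵇ a) ≡ true → (c <ᵇ b) ≡ true
  c<b c _ e = T⇒≡true (<⇒<ᵇ (<-trans (<ᵇ⇒< c a (≡true⇒T e)) a<b))

rank-injective : (w : List ℕ) {a b : ℕ} → a ∈ w → b ∈ w → rank w a ≡ rank w b → a ≡ b
rank-injective w {a} {b} a∈ b∈ e with <-cmp a b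
... | tri< a<b _ _ = ⊥-elim (<-irrefl e (rank-< w a∈ a<b))
... | tri≈ _ a≡b _ = a≡b
... | tri> _ _ b<a = ⊥-elim (<-irrefl (sym e) (rank-< w b∈ b<a))

-- f is order preserving on the entries of v, in the boolean form used by des, inv and red
OrderPreservingOn : (ℕ → ℕ) → List ℕ → Set
OrderPreservingOn f v = ∀ a b → a ∈ v → b ∈ v → (f b <ᵇ f a) ≡ (b <ᵇ a)

rank-orderPreserving : (w : List ℕ) → OrderPreservingOn (suc ∘ rank w) w
rank-orderPreserving w a b a∈ b∈ = <ᵇ-≡ reflect (λ b<a → s≤s (rank-< w b∈ b<a))
  where
  reflect : suc (rank w b) < suc (rank w a) → b < a
  reflect (s≤s rb<ra) with <-cmp b a
  ... | tri< b<a _ _ = b<a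
  ... | tri≈ _ refl _ = ⊥-elim (<-irrefl refl rb<ra)
  ... | tri> _ _ a<b = ⊥-elim (<⇒≱ rb<ra (<⇒≤ (rank-< w a∈ a<b)))

red-map : (f : ℕ → ℕ) (v : List ℕ) → OrderPreservingOn f v → red (map f v) ≡ red v
red-map f v mono = trans (sym (map-∘ v)) (map-cong-local (tabulate λ {a} a∈ →
  cong suc (trans (count-map (λ b → b <ᵇ f a) f v) (count-cong _ _ v (λ b b∈ → mono a b a∈ b∈)))))

des-map : (f : ℕ → ℕ) (v : List ℕ) → OrderPreservingOn f v → des (map f v) ≡ des v
des-map f [] mono = refl
des-map f (x ∷ []) mono = refl
des-map f (x ∷ y ∷ v) mono = cong₂ (λ a c → bit a + c) (mono x y (here refl) (there (here refl)))
  (des-map f (y ∷ v) (λ a b a∈ b∈ → mono a b (there a∈) (there b∈)))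

inv-map : (f : ℕ → ℕ) (v : List ℕ) → OrderPreservingOn f v → inv (map f v) ≡ inv v
inv-map f [] mono = refl
inv-map f (x ∷ v) mono = cong₂ _+_
  (trans (count-map (λ y → y <ᵇ f x) f v) (count-cong _ _ v (λ b b∈ → mono x b (here refl) (there b∈))))
  (inv-map f v (λ a b a∈ b∈ → mono a b (there a∈) (there b∈)))

∈-take : {A : Set} (n : ℕ) (v : List A) {x : A} → x ∈ take n v → x ∈ v
∈-take (suc n) (y ∷ v) (here e) = here e
∈-take (suc n) (y ∷ v) (there m) = there (∈-take n v m)

∈-drop : {A : Set} (n : ℕ) (v : List A) {x : A} → x ∈ drop n v → x ∈ v
∈-drop zero v m = m
∈-drop (suc n) (y ∷ v) m = there (∈-drop n v m)

length-red : (w : List ℕ) → length (red w) ≡ length w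
length-red w = length-map _ w

red-factor : (w : List ℕ) (k r : ℕ) → red (take k (drop r (red w))) ≡ red (take k (drop r w))
red-factor w k r = begin
  red (take k (drop r (red w)))            ≡⟨ cong (red ∘ take k) (drop-map r w) ⟩
  red (take k (map f (drop r w)))          ≡⟨ cong red (take-map k (drop r w)) ⟩
  red (map f (take k (drop r w)))          ≡⟨ red-map f (take k (drop r w)) mono ⟩
  red (take k (drop r w))                  ∎
  where
  open ≡-Reasoning
  f : ℕ → ℕ
  f = suc ∘ rank w
  mono : OrderPreservingOn f (take k (drop r w))
  mono a b a∈ b∈ = rank-orderPreserving w a b (∈-drop r w (∈-take k _ a∈)) (∈-drop r w (∈-take k _ b∈))

red∈S : (w : List ℕ) → Unique w → red w ∈ S (length w)
red∈S w u = ∈S⁺ (length w) (red w) (length-map _ w , tabulate inRange ,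
  Unique-map _ w (λ a∈ b∈ e → rank-injective w a∈ b∈ (suc-injective e)) u)
  where
  inRange : ∀ {x} → x ∈ red w → x ∈ range (length w)
  inRange m with ∈-map⁻ (suc ∘ rank w) m
  ... | a , a∈ , refl = ∈-map⁺ suc (∈-upTo⁺ (count-<-length (λ b → b <ᵇ a) w a a∈ (<ᵇ-irrefl a)))

rank-upTo : (i j : ℕ) → i ≤ j → countᵇ (λ k → k <ᵇ i) (upTo j) ≡ i
rank-upTo zero j _ = count-none _ (upTo j) (λ _ _ → refl)
rank-upTo (suc i) (suc j) (s≤s i≤j) = cong suc (begin
  countᵇ (λ k → k <ᵇ suc i) (applyUpTo suc j)   ≡⟨ cong (countᵇ (λ k → k <ᵇ suc i)) (map-upTo suc j) ⟨
  countᵇ (λ k → k <ᵇ suc i) (map suc (upTo j))  ≡⟨ count-map _ suc (upTo j) ⟩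
  countᵇ (λ k → k <ᵇ i) (upTo j)                ≡⟨ rank-upTo i j i≤j ⟩
  i                                             ∎)
  where open ≡-Reasoning

red-perm : (n : ℕ) (π : List ℕ) → π ∈ S n → red π ≡ π
red-perm n π π∈ = map-id-local (tabulate λ {b} b∈ → fixed b (∈-resp-↭ π↭ b∈))
  where
  π↭ : π ↭ range n
  π↭ = S↭range n π π∈
  fixed : ∀ b → b ∈ range n → suc (rank π b) ≡ b
  fixed b b∈ with ∈-map⁻ suc b∈
  ... | i , i∈ , refl = cong suc (begin
    rank π (suc i)                              ≡⟨ count-↭ _ π↭ ⟩
    countᵇ (λ c → c <ᵇ suc i) (map suc (upTo n)) ≡⟨ count-map _ suc (upTo n) ⟩
    countᵇ (λ c → c <ᵇ i) (upTo n)               ≡⟨ rank-upTo i n (<⇒≤ (∈-upTo⁻ i∈)) ⟩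
    i                                            ∎)
    where open ≡-Reasoning

-- sel W b = the entry of W of rank b, the inverse of suc ∘ rank W on the entries of W
selFrom : List ℕ → List ℕ → ℕ → ℕ
selFrom W [] b = 0
selFrom W (x ∷ xs) b = if suc (rank W x) ≡ᵇ b then x else selFrom W xs b

sel : List ℕ → ℕ → ℕ
sel W = selFrom W W

selFrom-rank : (W xs : List ℕ) → (∀ {y} → y ∈ xs → y ∈ W) → {x : ℕ} → x ∈ xs → selFrom W xs (suc (rank W x)) ≡ x
selFrom-rank W (y ∷ xs) sub {x} x∈ with suc (rank W y) ≡ᵇ suc (rank W x) in e
... | true = rank-injective W (sub (here refl)) (sub x∈) (suc-injective (≡ᵇ⇒≡ _ _ (≡true⇒T e)))
... | false with x∈
...   | here refl = ⊥-elim (subst T e (≡⇒≡ᵇ (suc (rank W y)) _ refl))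
...   | there m = selFrom-rank W xs (λ z → sub (there z)) m

sel-rank : (W : List ℕ) {x : ℕ} → x ∈ W → sel W (suc (rank W x)) ≡ x
sel-rank W = selFrom-rank W W (λ z → z)

sel-red : (W : List ℕ) → map (sel W) (red W) ≡ W
sel-red W = trans (sym (map-∘ W)) (map-id-local (tabulate (sel-rank W)))

sel-orderPreserving : (W : List ℕ) → OrderPreservingOn (sel W) (red W)
sel-orderPreserving W a b a∈ b∈ with ∈-map⁻ (suc ∘ rank W) a∈ | ∈-map⁻ (suc ∘ rank W) b∈
... | x , x∈ , refl | y , y∈ , refl rewrite sel-rank W x∈ | sel-rank W y∈ = sym (rank-orderPreserving W x y x∈ y∈)

sel-↭ : {W W′ : List ℕ} → W′ ↭ W → {a : ℕ} → a ∈ red W → sel W′ a ≡ sel W a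
sel-↭ {W} {W′} p a∈ with ∈-map⁻ (suc ∘ rank W) a∈
... | x , x∈ , refl = begin
  sel W′ (suc (rank W x))   ≡⟨ cong (sel W′ ∘ suc) (count-↭ _ (↭-sym p)) ⟩
  sel W′ (suc (rank W′ x))  ≡⟨ sel-rank W′ (∈-resp-↭ (↭-sym p) x∈) ⟩
  x                         ≡⟨ sel-rank W x∈ ⟨
  sel W (suc (rank W x))    ∎
  where open ≡-Reasoning

take-++ : {A : Set} (xs ys : List A) {g : ℕ} → length xs ≡ g → take g (xs ++ ys) ≡ xs
take-++ [] ys refl = refl
take-++ (x ∷ xs) ys refl = cong (x ∷_) (take-++ xs ys refl)

drop-++ : {A : Set} (xs ys : List A) {g : ℕ} → length xs ≡ g → drop g (xs ++ ys) ≡ ys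
drop-++ [] ys refl = refl
drop-++ (x ∷ xs) ys refl = drop-++ xs ys refl

++-injective : {A : Set} (xs us : List A) {ys vs : List A} → length xs ≡ length us →
  xs ++ ys ≡ us ++ vs → xs ≡ us × ys ≡ vs
++-injective [] [] _ e = refl , e
++-injective (x ∷ xs) (u ∷ us) len e with ∷-injective e
... | refl , e′ = let (e₁ , e₂) = ++-injective xs us (suc-injective len) e′ in cong (x ∷_) e₁ , e₂

last-just : (k : ℕ) (xs : List ℕ) → length xs ≡ suc k → Σ ℕ λ z → last xs ≡ just z
last-just zero (x ∷ []) _ = x , refl
last-just (suc k) (x ∷ y ∷ xs) len = last-just k (y ∷ xs) (suc-injective len)

length-snoc : {A : Set} (xs : List A) (y : A) → length (xs ++ y ∷ []) ≡ suc (length xs)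
length-snoc xs y = trans (length-++ xs) (+-comm (length xs) 1)

split-last : (k : ℕ) (xs : List ℕ) {z : ℕ} → length xs ≡ suc k → last xs ≡ just z → xs ≡ take k xs ++ z ∷ []
split-last zero (x ∷ []) _ refl = refl
split-last (suc k) (x ∷ y ∷ xs) len e = cong (x ∷_) (split-last k (y ∷ xs) (suc-injective len) e)

take-head : (k : ℕ) → 1 ≤ k → (xs : List ℕ) {a : ℕ} → head xs ≡ just a → Σ (List ℕ) λ t → take k xs ≡ a ∷ t
take-head (suc k) _ (x ∷ xs) e with just-injective e
... | refl = take k xs , refl

take-1-++ : (A : List ℕ) {xs ys : List ℕ} → take 1 xs ≡ take 1 ys → take 1 (A ++ xs) ≡ take 1 (A ++ ys)
take-1-++ [] e = e
take-1-++ (a ∷ A) e = refl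

take-1 : (xs : List ℕ) {h : ℕ} → take 1 xs ≡ h ∷ [] → Σ (List ℕ) λ t → xs ≡ h ∷ t
take-1 (x ∷ xs) e with ∷-injective e
... | refl , _ = xs , refl

factor-split : {A : Set} (g k : ℕ) (τ : List A) → length (take (suc k) (drop g τ)) ≡ suc k →
  Σ (List A) λ P → Σ (List A) λ X → Σ A λ h → Σ (List A) λ Q →
    τ ≡ P ++ X ++ h ∷ Q × length P ≡ g × length X ≡ k
factor-split (suc g) k (x ∷ τ) e with factor-split g k τ e
... | P , X , h , Q , refl , refl , refl = x ∷ P , X , h , Q , refl , refl , refl
factor-split zero zero (x ∷ τ) e = [] , [] , x , τ , refl , refl , refl
factor-split zero (suc k) (x ∷ τ) e with factor-split zero k τ (suc-injective e)
... | [] , X , h , Q , refl , refl , refl = [] , x ∷ X , h , Q , refl , refl , refl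

factor-parts : (A X : List ℕ) (h : ℕ) (Q : List ℕ) {g k : ℕ} → length A ≡ g → length X ≡ k →
  take g (A ++ X ++ h ∷ Q) ≡ A × take (suc k) (drop g (A ++ X ++ h ∷ Q)) ≡ X ++ h ∷ [] ×
  drop (g + k) (A ++ X ++ h ∷ Q) ≡ h ∷ Q
factor-parts A X h Q {g} {k} lA lX =
  take-++ A _ lA ,
  trans (cong (take (suc k)) (drop-++ A _ lA)) (take-snoc X lX) ,
  trans (sym (drop-drop g k (A ++ X ++ h ∷ Q))) (trans (cong (drop k) (drop-++ A _ lA)) (drop-++ X _ lX))
  where
  take-snoc : (X : List ℕ) {k : ℕ} → length X ≡ k → take (suc k) (X ++ h ∷ Q) ≡ X ++ h ∷ []
  take-snoc [] refl = refl
  take-snoc (x ∷ X) refl = cong (x ∷_) (take-snoc X refl)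

-- descents only involve adjacent letters, so des splits at a letter h
des-split : (P : List ℕ) (h : ℕ) (Q : List ℕ) → des (P ++ h ∷ Q) ≡ des (P ++ h ∷ []) + des (h ∷ Q)
des-split [] h Q = refl
des-split (x ∷ []) h Q = cong (_+ des (h ∷ Q)) (sym (+-identityʳ _))
des-split (x ∷ y ∷ P) h Q = trans (cong (bit (y <ᵇ x) +_) (des-split (y ∷ P) h Q)) (sym (+-assoc (bit (y <ᵇ x)) _ _))

des-factor : (A : List ℕ) (x : ℕ) (X : List ℕ) (h : ℕ) (Q : List ℕ) →
  des (A ++ (x ∷ X) ++ h ∷ Q) ≡ des (A ++ x ∷ []) + des ((x ∷ X) ++ h ∷ []) + des (h ∷ Q)
des-factor A x X h Q = begin
  des (A ++ (x ∷ X) ++ h ∷ Q)                         ≡⟨ cong des (++-assoc A (x ∷ X) (h ∷ Q)) ⟨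
  des ((A ++ x ∷ X) ++ h ∷ Q)                         ≡⟨ des-split (A ++ x ∷ X) h Q ⟩
  des ((A ++ x ∷ X) ++ h ∷ []) + des (h ∷ Q)          ≡⟨ cong (λ d → des d + des (h ∷ Q)) (++-assoc A (x ∷ X) (h ∷ [])) ⟩
  des (A ++ x ∷ X ++ h ∷ []) + des (h ∷ Q)            ≡⟨ cong (_+ des (h ∷ Q)) (des-split A x (X ++ h ∷ [])) ⟩
  des (A ++ x ∷ []) + des ((x ∷ X) ++ h ∷ []) + des (h ∷ Q) ∎
  where open ≡-Reasoning

des-splice : (A : List ℕ) (x : ℕ) {X Y : List ℕ} (h : ℕ) {Q Q′ : List ℕ} →
  des ((x ∷ Y) ++ h ∷ []) ≡ des ((x ∷ X) ++ h ∷ []) → des (h ∷ Q′) ≡ des (h ∷ Q) →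
  des (A ++ (x ∷ Y) ++ h ∷ Q′) ≡ des (A ++ (x ∷ X) ++ h ∷ Q)
des-splice A x {X} {Y} h {Q} {Q′} eY eQ = begin
  des (A ++ (x ∷ Y) ++ h ∷ Q′)                           ≡⟨ des-factor A x Y h Q′ ⟩
  des (A ++ x ∷ []) + des ((x ∷ Y) ++ h ∷ []) + des (h ∷ Q′) ≡⟨ cong₂ (λ a b → des (A ++ x ∷ []) + a + b) eY eQ ⟩
  des (A ++ x ∷ []) + des ((x ∷ X) ++ h ∷ []) + des (h ∷ Q)  ≡⟨ des-factor A x X h Q ⟨
  des (A ++ (x ∷ X) ++ h ∷ Q)                            ∎
  where open ≡-Reasoning

-- the inversions between a left part P and a right part Q
cross : List ℕ → List ℕ → ℕ
cross P Q = sum (map (rank Q) P)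

inv-++ : (P Q : List ℕ) → inv (P ++ Q) ≡ inv P + inv Q + cross P Q
inv-++ [] Q = sym (+-identityʳ (inv Q))
inv-++ (x ∷ P) Q = begin
  rank (P ++ Q) x + inv (P ++ Q)                          ≡⟨ cong₂ _+_ (count-++ (λ y → y <ᵇ x) P Q) (inv-++ P Q) ⟩
  (rank P x + rank Q x) + (inv P + inv Q + cross P Q)     ≡⟨ regroup (rank P x) (rank Q x) (inv P) (inv Q) (cross P Q) ⟩
  rank P x + inv P + inv Q + (rank Q x + cross P Q)       ∎
  where
  open ≡-Reasoning
  regroup : ∀ a b c d e → (a + b) + (c + d + e) ≡ a + c + d + (b + e)
  regroup = solve-∀

cross-↭ : {P P′ Q Q′ : List ℕ} → P ↭ P′ → Q ↭ Q′ → cross P Q ≡ cross P′ Q′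
cross-↭ {P} {P′} {Q} {Q′} p q = trans (sum-↭ (map⁺ (rank Q) p))
  (cong sum (map-cong-local {xs = P′} (tabulate λ {x} _ → count-↭ (λ y → y <ᵇ x) q)))

inv-splice : (A : List ℕ) {X Y R R′ : List ℕ} → Y ↭ X → inv Y ≡ inv X → R′ ↭ R → inv R′ ≡ inv R →
  inv (A ++ Y ++ R′) ≡ inv (A ++ X ++ R)
inv-splice A {X} {Y} {R} {R′} Y↭X eY R′↭R eR = begin
  inv (A ++ Y ++ R′)                                         ≡⟨ inv-++ A (Y ++ R′) ⟩
  inv A + inv (Y ++ R′) + cross A (Y ++ R′)                  ≡⟨ cong₂ (λ a b → inv A + a + b) (inv-++ Y R′) (cross-↭ (↭.refl {xs = A}) (++⁺ Y↭X R′↭R)) ⟩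
  inv A + (inv Y + inv R′ + cross Y R′) + cross A (X ++ R)   ≡⟨ cong (λ a → inv A + a + cross A (X ++ R)) (cong₂ _+_ (cong₂ _+_ eY eR) (cross-↭ Y↭X R′↭R)) ⟩
  inv A + (inv X + inv R + cross X R) + cross A (X ++ R)     ≡⟨ cong (λ a → inv A + a + cross A (X ++ R)) (inv-++ X R) ⟨
  inv A + inv (X ++ R) + cross A (X ++ R)                    ≡⟨ inv-++ A (X ++ R) ⟨
  inv (A ++ X ++ R)                                          ∎
  where open ≡-Reasoning

Spaced : ℕ → ℕ → List ℕ → Set
Spaced k off [] = ⊤
Spaced k off (i ∷ M) = off ≤ i × Spaced k (i + k) M

-- Valid k ε off M τ, for τ the suffix of a word σ from position off: the positions of M are spaced
-- and the factor of length suc k of σ at each of them has pattern ε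
Valid : ℕ → List ℕ → ℕ → List ℕ → List ℕ → Set
Valid k ε off [] τ = ⊤
Valid k ε off (i ∷ M) τ =
  off ≤ i × red (take (suc k) (drop (i ∸ off) τ)) ≡ ε × Valid k ε (i + k) M (drop (i ∸ off + k) τ)

-- the replacement map: for each position i of M rearrange the first k letters of the factor W of
-- length suc k at i into the pattern ε, i.e. replace them by map (sel W) ε
replace : ℕ → List ℕ → ℕ → List ℕ → List ℕ → List ℕ
replace k ε off [] τ = τ
replace k ε off (i ∷ M) τ =
  take (i ∸ off) τ ++ map (sel (take (suc k) (drop (i ∸ off) τ))) ε ++ replace k ε (i + k) M (drop (i ∸ off + k) τ)

drop-∸ : (σ : List ℕ) {off i : ℕ} → off ≤ i → drop (i ∸ off) (drop off σ) ≡ drop i σ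
drop-∸ σ {off} {i} off≤i = trans (drop-drop off (i ∸ off) σ) (cong (λ n → drop n σ) (m+[n∸m]≡n off≤i))

drop-∸+ : (σ : List ℕ) (k : ℕ) {off i : ℕ} → off ≤ i → drop (i ∸ off + k) (drop off σ) ≡ drop (i + k) σ
drop-∸+ σ k {off} {i} off≤i = trans (drop-drop off (i ∸ off + k) σ)
  (cong (λ n → drop n σ) (trans (sym (+-assoc off (i ∸ off) k)) (cong (_+ k) (m+[n∸m]≡n off≤i))))

Valid⁺ : (k : ℕ) (ε σ : List ℕ) (off : ℕ) (M : List ℕ) → Spaced k off M →
  (∀ i → i ∈ M → red (take (suc k) (drop i σ)) ≡ ε) → Valid k ε off M (drop off σ)
Valid⁺ k ε σ off [] _ _ = tt
Valid⁺ k ε σ off (i ∷ M) (off≤i , sp) match =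
  off≤i ,
  subst (λ τ → red (take (suc k) τ) ≡ ε) (sym (drop-∸ σ off≤i)) (match i (here refl)) ,
  subst (Valid k ε (i + k) M) (sym (drop-∸+ σ k off≤i)) (Valid⁺ k ε σ (i + k) M sp (λ i′ m → match i′ (there m)))

Valid⁻ : (k : ℕ) (ε σ : List ℕ) (off : ℕ) (M : List ℕ) → Valid k ε off M (drop off σ) →
  ∀ i → i ∈ M → red (take (suc k) (drop i σ)) ≡ ε
Valid⁻ k ε σ off (i ∷ M) (off≤i , e , v) .i (here refl) = subst (λ τ → red (take (suc k) τ) ≡ ε) (drop-∸ σ off≤i) e
Valid⁻ k ε σ off (i ∷ M) (off≤i , e , v) i′ (there m) =
  Valid⁻ k ε σ (i + k) M (subst (Valid k ε (i + k) M) (drop-∸+ σ k off≤i) v) i′ m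

-- Replacing γ-factors by δ-factors on the same values preserves des (and inv when
-- inv γ = inv δ), and is undone by the reverse replacement.
module PatternSwap (k : ℕ) (γ δ : List ℕ) (γ∈ : γ ∈ S (suc k)) (δ∈ : δ ∈ S (suc k)) (k≥1 : 1 ≤ k)
  (γ₁ : head γ ≡ just 1) (δ₁ : head δ ≡ just 1) (last≡ : last γ ≡ last δ) (des≡ : des γ ≡ des δ) where

  γ′ δ′ : List ℕ
  γ′ = take k γ
  δ′ = take k δ

  length-γ : length γ ≡ suc k
  length-γ = proj₁ (∈S⁻ (suc k) γ γ∈)

  length-δ : length δ ≡ suc k
  length-δ = proj₁ (∈S⁻ (suc k) δ δ∈)

  z : ℕ
  z = proj₁ (last-just k γ length-γ)

  γ-split : γ ≡ γ′ ++ z ∷ []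
  γ-split = split-last k γ length-γ (proj₂ (last-just k γ length-γ))

  δ-split : δ ≡ δ′ ++ z ∷ []
  δ-split = split-last k δ length-δ (trans (sym last≡) (proj₂ (last-just k γ length-γ)))

  -- γ and δ are rearrangements of 1 ⋯ suc k, so γ′ and δ′ consist of the same letters
  γ↭δ : γ ↭ δ
  γ↭δ = ↭-trans (S↭range (suc k) γ γ∈) (↭-sym (S↭range (suc k) δ δ∈))

  γ′↭δ′ : γ′ ↭ δ′
  γ′↭δ′ = subst₂ _↭_ (++-identityʳ γ′) (++-identityʳ δ′) (drop-mid γ′ δ′ (subst₂ _↭_ γ-split δ-split γ↭δ))

  length-γ′ : length γ′ ≡ k
  length-γ′ = suc-injective (trans (sym (length-snoc γ′ z)) (trans (cong length (sym γ-split)) length-γ))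

  length-δ′ : length δ′ ≡ k
  length-δ′ = suc-injective (trans (sym (length-snoc δ′ z)) (trans (cong length (sym δ-split)) length-δ))

  -- removing the common last letter z keeps inv equal, as the inversions across only depend on the
  -- letters of γ′ and δ′
  inv′≡ : inv γ ≡ inv δ → inv γ′ ≡ inv δ′
  inv′≡ e = +-cancelʳ-≡ (cross γ′ (z ∷ [])) (inv γ′) (inv δ′) (begin
    inv γ′ + cross γ′ (z ∷ [])       ≡⟨ cong (_+ cross γ′ (z ∷ [])) (+-identityʳ _) ⟨
    inv γ′ + 0 + cross γ′ (z ∷ [])   ≡⟨ inv-++ γ′ (z ∷ []) ⟨
    inv (γ′ ++ z ∷ [])               ≡⟨ cong inv γ-split ⟨
    inv γ                            ≡⟨ e ⟩
    inv δ                            ≡⟨ cong inv δ-split ⟩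
    inv (δ′ ++ z ∷ [])               ≡⟨ inv-++ δ′ (z ∷ []) ⟩
    inv δ′ + 0 + cross δ′ (z ∷ [])   ≡⟨ cong₂ _+_ (+-identityʳ _) (cross-↭ (↭-sym γ′↭δ′) (↭.refl {xs = z ∷ []})) ⟩
    inv δ′ + cross γ′ (z ∷ [])       ∎)
    where open ≡-Reasoning

  δ⊆γ : ∀ {x} → x ∈ δ → x ∈ γ
  δ⊆γ = ∈-resp-↭ (↭-sym γ↭δ)

  γ′⊆γ : ∀ {x} → x ∈ γ′ → x ∈ γ
  γ′⊆γ = ∈-take k γ

  δ′⊆γ : ∀ {x} → x ∈ δ′ → x ∈ γ
  δ′⊆γ m = δ⊆γ (∈-take k δ m)

  module Factor (W : List ℕ) (W-γ : red W ≡ γ) where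

    sel-mono : OrderPreservingOn (sel W) γ
    sel-mono = subst (OrderPreservingOn (sel W)) W-γ (sel-orderPreserving W)

    sel-mono-on : {v : List ℕ} → (∀ {x} → x ∈ v → x ∈ γ) → OrderPreservingOn (sel W) v
    sel-mono-on sub a b a∈ b∈ = sel-mono a b (sub a∈) (sub b∈)

    W≡ : W ≡ map (sel W) γ
    W≡ = trans (sym (sel-red W)) (cong (map (sel W)) W-γ)

    W′ X Y : List ℕ
    W′ = map (sel W) δ
    X = map (sel W) γ′
    Y = map (sel W) δ′

    h : ℕ
    h = sel W z

    red-W′ : red W′ ≡ δ
    red-W′ = trans (red-map (sel W) δ (sel-mono-on δ⊆γ)) (red-perm (suc k) δ δ∈)

    des-W′ : des W′ ≡ des W
    des-W′ = begin
      des (map (sel W) δ)  ≡⟨ des-map (sel W) δ (sel-mono-on δ⊆γ) ⟩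
      des δ                ≡⟨ des≡ ⟨
      des γ                ≡⟨ des-map (sel W) γ sel-mono ⟨
      des (map (sel W) γ)  ≡⟨ cong des W≡ ⟨
      des W                ∎
      where open ≡-Reasoning

    W-split : W ≡ X ++ h ∷ []
    W-split = trans W≡ (trans (cong (map (sel W)) γ-split) (map-++ (sel W) γ′ (z ∷ [])))

    W′-split : W′ ≡ Y ++ h ∷ []
    W′-split = trans (cong (map (sel W)) δ-split) (map-++ (sel W) δ′ (z ∷ []))

    Y↭X : Y ↭ X
    Y↭X = map⁺ (sel W) (↭-sym γ′↭δ′)

    inv-Y : inv γ ≡ inv δ → inv Y ≡ inv X
    inv-Y e = trans (inv-map (sel W) δ′ (sel-mono-on δ′⊆γ))
      (trans (sym (inv′≡ e)) (sym (inv-map (sel W) γ′ (sel-mono-on γ′⊆γ))))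

    X-head : Σ (List ℕ) λ t → X ≡ sel W 1 ∷ t
    X-head = let (t , e) = take-head k k≥1 γ γ₁ in map (sel W) t , cong (map (sel W)) e

    Y-head : Σ (List ℕ) λ t → Y ≡ sel W 1 ∷ t
    Y-head = let (t , e) = take-head k k≥1 δ δ₁ in map (sel W) t , cong (map (sel W)) e

    back : map (sel W′) γ′ ≡ X
    back = map-cong-local (tabulate λ m → sel-↭ W′↭W (subst (_ ∈_) (sym W-γ) (γ′⊆γ m)))
      where
      W′↭W : W′ ↭ W
      W′↭W = subst₂ _↭_ (sym W′-split) (sym W-split) (++⁺ʳ (h ∷ []) Y↭X)

    cut : (X′ : List ℕ) (h′ : ℕ) → W ≡ X′ ++ h′ ∷ [] → length X′ ≡ k → X′ ≡ X × h′ ≡ h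
    cut X′ h′ e len with ++-injective X′ X (trans len (sym (trans (length-map (sel W) γ′) length-γ′))) (trans (sym e) W-split)
    ... | e₁ , e₂ = e₁ , proj₁ (∷-injective e₂)

  forward backward : ℕ → List ℕ → List ℕ → List ℕ
  forward = replace k δ′
  backward = replace k γ′

  -- what the forward replacement achieves on a suffix τ, for the positions M (from offset off)
  record Swapped (off : ℕ) (M τ : List ℕ) : Set where
    field
      perm   : forward off M τ ↭ τ
      first  : take 1 (forward off M τ) ≡ take 1 τ
      valid  : Valid k δ off M (forward off M τ)
      undo   : backward off M (forward off M τ) ≡ τ
      des-eq : des (forward off M τ) ≡ des τ
      inv-eq : inv γ ≡ inv δ → inv (forward off M τ) ≡ inv τ

  -- one replacement step: τ = A ++ X ++ h ∷ Q where X ++ [h] is the factor with pattern γ at position |A|,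
  -- and the replacements further right are already known to behave well on h ∷ Q
  module Step (off i : ℕ) (M A X : List ℕ) (h : ℕ) (Q : List ℕ) (off≤i : off ≤ i)
    (len-A : length A ≡ i ∸ off) (len-X : length X ≡ k)
    (W-γ : red (take (suc k) (drop (i ∸ off) (A ++ X ++ h ∷ Q))) ≡ γ)
    (IH : Swapped (i + k) M (h ∷ Q)) where

    g : ℕ
    g = i ∸ off

    τ W : List ℕ
    τ = A ++ X ++ h ∷ Q
    W = take (suc k) (drop g τ)

    open Factor W W-γ using (Y; Y↭X; red-W′; des-W′; W′-split; inv-Y; X-head; Y-head; back; cut)
      renaming (X to X₀; h to h₀)
    module IH = Swapped IH

    parts : take g τ ≡ A × W ≡ X ++ h ∷ [] × drop (g + k) τ ≡ h ∷ Q
    parts = factor-parts A X h Q len-A len-X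

    X≡X₀ : X ≡ X₀
    X≡X₀ = proj₁ (cut X h (proj₁ (proj₂ parts)) len-X)

    h≡h₀ : h ≡ h₀
    h≡h₀ = proj₂ (cut X h (proj₁ (proj₂ parts)) len-X)

    Q′ : List ℕ
    Q′ = proj₁ (take-1 (forward (i + k) M (h ∷ Q)) IH.first)

    rest : forward (i + k) M (h ∷ Q) ≡ h ∷ Q′
    rest = proj₂ (take-1 (forward (i + k) M (h ∷ Q)) IH.first)

    τ′ : List ℕ
    τ′ = A ++ Y ++ h ∷ Q′

    unfold : forward off (i ∷ M) τ ≡ τ′
    unfold = cong₂ (λ a b → a ++ Y ++ b) (proj₁ parts) (trans (cong (forward (i + k) M) (proj₂ (proj₂ parts))) rest)

    parts′ : take g τ′ ≡ A × take (suc k) (drop g τ′) ≡ Y ++ h ∷ [] × drop (g + k) τ′ ≡ h ∷ Q′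
    parts′ = factor-parts A Y h Q′ len-A (trans (length-map _ δ′) length-δ′)

    W′-at : take (suc k) (drop g τ′) ≡ map (sel W) δ
    W′-at = trans (proj₁ (proj₂ parts′)) (trans (cong (λ x → Y ++ x ∷ []) h≡h₀) (sym W′-split))

    Y↭X′ : Y ↭ X
    Y↭X′ = subst (Y ↭_) (sym X≡X₀) Y↭X

    rest↭ : h ∷ Q′ ↭ h ∷ Q
    rest↭ = subst (_↭ h ∷ Q) rest IH.perm

    perm : τ′ ↭ τ
    perm = ++⁺ˡ A (++⁺ Y↭X′ rest↭)

    first : take 1 τ′ ≡ take 1 τ
    first with X-head | Y-head
    ... | tX , eX | tY , eY = take-1-++ A (trans (cong (λ y → take 1 (y ++ h ∷ Q′)) eY) (cong (λ x → take 1 (x ++ h ∷ Q)) (sym (trans X≡X₀ eX))))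

    valid : Valid k δ off (i ∷ M) τ′
    valid = off≤i , trans (cong red W′-at) red-W′ ,
      subst (Valid k δ (i + k) M) (sym (proj₂ (proj₂ parts′))) (subst (Valid k δ (i + k) M) rest IH.valid)

    undo : backward off (i ∷ M) τ′ ≡ τ
    undo = begin
      backward off (i ∷ M) τ′
        ≡⟨ cong₂ (λ a b → a ++ map (sel (take (suc k) (drop g τ′))) γ′ ++ backward (i + k) M b) (proj₁ parts′) (proj₂ (proj₂ parts′)) ⟩
      A ++ map (sel (take (suc k) (drop g τ′))) γ′ ++ backward (i + k) M (h ∷ Q′)
        ≡⟨ cong (λ w → A ++ map (sel w) γ′ ++ backward (i + k) M (h ∷ Q′)) W′-at ⟩
      A ++ map (sel (map (sel W) δ)) γ′ ++ backward (i + k) M (h ∷ Q′)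
        ≡⟨ cong₂ (λ a b → A ++ a ++ b) (trans back (sym X≡X₀)) (trans (cong (backward (i + k) M) (sym rest)) IH.undo) ⟩
      τ ∎
      where open ≡-Reasoning

    des-eq : des τ′ ≡ des τ
    des-eq with X-head | Y-head
    ... | tX , eX | tY , eY = begin
      des (A ++ Y ++ h ∷ Q′)                    ≡⟨ cong (λ y → des (A ++ y ++ h ∷ Q′)) eY ⟩
      des (A ++ (_ ∷ tY) ++ h ∷ Q′)             ≡⟨ des-splice A _ h factor-des (trans (cong des (sym rest)) IH.des-eq) ⟩
      des (A ++ (_ ∷ tX) ++ h ∷ Q)              ≡⟨ cong (λ x → des (A ++ x ++ h ∷ Q)) (trans X≡X₀ eX) ⟨
      des τ                                     ∎
      where
      open ≡-Reasoning
      factor-des : des ((_ ∷ tY) ++ h ∷ []) ≡ des ((_ ∷ tX) ++ h ∷ [])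
      factor-des = begin
        des ((_ ∷ tY) ++ h ∷ [])    ≡⟨ cong (λ y → des (y ++ h ∷ [])) eY ⟨
        des (Y ++ h ∷ [])           ≡⟨ cong des (trans (sym (proj₁ (proj₂ parts′))) W′-at) ⟩
        des (map (sel W) δ)         ≡⟨ des-W′ ⟩
        des W                       ≡⟨ cong des (proj₁ (proj₂ parts)) ⟩
        des (X ++ h ∷ [])           ≡⟨ cong (λ x → des (x ++ h ∷ [])) (trans X≡X₀ eX) ⟩
        des ((_ ∷ tX) ++ h ∷ [])    ∎

    inv-eq : inv γ ≡ inv δ → inv τ′ ≡ inv τ
    inv-eq e = inv-splice A Y↭X′ (trans (inv-Y e) (cong inv (sym X≡X₀))) rest↭ (trans (cong inv (sym rest)) (IH.inv-eq e))

    result : Swapped off (i ∷ M) τ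
    result = record
      { perm   = subst (_↭ τ) (sym unfold) perm
      ; first  = trans (cong (take 1) unfold) first
      ; valid  = subst (Valid k δ off (i ∷ M)) (sym unfold) valid
      ; undo   = trans (cong (backward off (i ∷ M)) unfold) undo
      ; des-eq = trans (cong des unfold) des-eq
      ; inv-eq = λ e → trans (cong inv unfold) (inv-eq e)
      }

  swap : (off : ℕ) (M τ : List ℕ) → Valid k γ off M τ → Swapped off M τ
  swap off [] τ _ = record { perm = ↭.refl ; first = refl ; valid = tt ; undo = refl ; des-eq = refl ; inv-eq = λ _ → refl }
  swap off (i ∷ M) τ (off≤i , W-γ , v) with factor-split (i ∸ off) k τ length-W
    where
    length-W : length (take (suc k) (drop (i ∸ off) τ)) ≡ suc k
    length-W = trans (sym (length-red (take (suc k) (drop (i ∸ off) τ)))) (trans (cong length W-γ) length-γ)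
  ... | A , X , h , Q , refl , len-A , len-X =
    Step.result off i M A X h Q off≤i len-A len-X W-γ
      (swap (i + k) M (h ∷ Q) (subst (Valid k γ (i + k) M) (proj₂ (proj₂ (factor-parts A X h Q len-A len-X))) v))

  swap-word : (n : ℕ) (M σ : List ℕ) → Spaced k 0 M → σ ∈ S n →
    (∀ i → i ∈ M → red (take (suc k) (drop i σ)) ≡ γ) →
    forward 0 M σ ∈ S n × (∀ i → i ∈ M → red (take (suc k) (drop i (forward 0 M σ))) ≡ δ) ×
    backward 0 M (forward 0 M σ) ≡ σ × des (forward 0 M σ) ≡ des σ × (inv γ ≡ inv δ → inv (forward 0 M σ) ≡ inv σ)
  swap-word n M σ sp σ∈ match =
    S-resp-↭ n (↭-sym perm) σ∈ , Valid⁻ k δ (forward 0 M σ) 0 M valid , undo , des-eq , inv-eq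
    where open Swapped (swap 0 M σ (Valid⁺ k γ σ 0 M sp match))

least-witness : (p : ℕ → Bool) (D : ℕ) → p D ≡ true →
  Σ ℕ λ d → d ≤ D × p d ≡ true × (∀ e → e < d → p e ≡ false)
least-witness p D pD with p 0 in p0
... | true = 0 , z≤n , p0 , λ _ ()
least-witness p zero pD | false with () ← trans (sym p0) pD
least-witness p (suc D) pD | false with least-witness (p ∘ suc) D pD
... | d , d≤D , pd , below = suc d , s≤s d≤D , pd , λ { zero _ → p0 ; (suc e) (s≤s e<d) → below e e<d }

count-two : (p : ℕ → Bool) (d : ℕ) → p 0 ≡ true → p (suc d) ≡ true → (∀ e → e < d → p (suc e) ≡ false) →
  countᵇ p (upTo (suc (suc d))) ≡ 2
count-two p d p0 pd below = begin
  countᵇ p (upTo (suc (suc d)))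
    ≡⟨ cong₂ (λ b c → bit b + c) p0 (trans (cong (countᵇ p) (sym (map-upTo suc (suc d)))) (count-map p suc (upTo (suc d)))) ⟩
  1 + countᵇ (p ∘ suc) (upTo (suc d))
    ≡⟨ cong (1 +_) (trans (cong (countᵇ (p ∘ suc)) (sym (upTo-∷ʳ d))) (count-++ (p ∘ suc) (upTo d) (d ∷ []))) ⟩
  1 + (countᵇ (p ∘ suc) (upTo d) + (bit (p (suc d)) + 0))
    ≡⟨ cong₂ (λ c b → 1 + (c + (bit b + 0))) (count-none _ (upTo d) (λ e m → below e (∈-upTo⁻ m))) pd ⟩
  2 ∎
  where open ≡-Reasoning

take-drop-take : {A : Set} (J r m : ℕ) (xs : List A) → r + J ≤ m → take J (drop r (take m xs)) ≡ take J (drop r xs)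
take-drop-take J zero m xs r+J≤m = trans (take-take J m xs) (cong (λ n → take n xs) (m≤n⇒m⊓n≡m r+J≤m))
take-drop-take J (suc r) (suc m) [] _ = refl
take-drop-take J (suc r) (suc m) (x ∷ xs) (s≤s r+J≤m) = take-drop-take J r m xs r+J≤m

matchAt-factor : (γ σ : List ℕ) (a m r : ℕ) → r + length γ ≤ m →
  matchAtᵇ γ (red (take m (drop a σ))) r ≡ matchAtᵇ γ σ (a + r)
matchAt-factor γ σ a m r bound = cong (λ w → eqListᵇ w γ) (begin
  red (take (length γ) (drop r (red (take m (drop a σ)))))   ≡⟨ red-factor (take m (drop a σ)) (length γ) r ⟩
  red (take (length γ) (drop r (take m (drop a σ))))         ≡⟨ cong red (take-drop-take (length γ) r m (drop a σ) bound) ⟩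
  red (take (length γ) (drop r (drop a σ)))                  ≡⟨ cong (red ∘ take (length γ)) (drop-drop a r σ) ⟩
  red (take (length γ) (drop (a + r) σ))                     ∎)
  where open ≡-Reasoning

-- under the minimal overlapping property, two γ-matches in a permutation are at least |γ| − 1 apart:
-- the closest pair of matches at distance d < |γ| − 1 would reduce to a permutation of size
-- d + |γ| < 2|γ| − 1 with exactly two matches
no-close-matches : (k : ℕ) (γ : List ℕ) → length γ ≡ suc k → MinimalOverlapping γ →
  (n : ℕ) (σ : List ℕ) → σ ∈ S n → (a D : ℕ) → suc D < k → a + suc D + suc k ≤ n →
  matchAtᵇ γ σ a ≡ true → matchAtᵇ γ σ (a + suc D) ≡ true → ⊥
no-close-matches k γ len-γ (_ , _ , minimal) n σ σ∈ a D D<k bound match₀ matchD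
  with least-witness (λ e → matchAtᵇ γ σ (a + suc e)) D matchD
... | d , d≤D , matchd , between = minimal (suc d + suc k) size σ′ σ′∈ two-matches
  where
  m : ℕ
  m = suc d + suc k

  w σ′ : List ℕ
  w = take m (drop a σ)
  σ′ = red w

  m≤ : m ≤ length (drop a σ)
  m≤ = subst (m ≤_) (sym (trans (length-drop a σ) (cong (_∸ a) (proj₁ (∈S⁻ n σ σ∈)))))
    (m+n≤o⇒m≤o∸n m (≤-trans (≤-reflexive (+-comm m a)) (≤-trans (≤-reflexive (sym (+-assoc a (suc d) (suc k))))
      (≤-trans (+-mono-≤ (+-monoʳ-≤ a (s≤s d≤D)) ≤-refl) bound))))

  length-w : length w ≡ m
  length-w = trans (length-take m (drop a σ)) (m≤n⇒m⊓n≡m m≤)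

  σ′∈ : σ′ ∈ S m
  σ′∈ = subst (λ l → σ′ ∈ S l) length-w (red∈S w (Unique.take⁺ m (Unique.drop⁺ a (proj₂ (proj₂ (∈S⁻ n σ σ∈))))))

  size : suc m ≤ 2 * length γ ∸ 1
  size = subst (λ l → suc m ≤ 2 * l ∸ 1) (sym len-γ) (+-mono-≤ (≤-trans (s≤s (s≤s d≤D)) D<k) (s≤s (≤-reflexive (sym (+-identityʳ k)))))

  positions-σ′ : positions (length γ) (length σ′) ≡ upTo (suc (suc d))
  positions-σ′ rewrite length-red w | length-w | len-γ
    | T⇒≡true (≤⇒≤ᵇ (m≤n+m (suc k) (suc d))) | m+n∸n≡m (suc d) (suc k) = refl

  two-matches : mch γ σ′ ≡ 2
  two-matches = begin
    countᵇ (matchAtᵇ γ σ′) (positions (length γ) (length σ′))  ≡⟨ cong (countᵇ (matchAtᵇ γ σ′)) positions-σ′ ⟩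
    countᵇ (matchAtᵇ γ σ′) (upTo (suc (suc d)))                ≡⟨ count-cong _ _ (upTo (suc (suc d))) (λ r r∈ → matchAt-factor γ σ a m r (in-factor r (∈-upTo⁻ r∈))) ⟩
    countᵇ (λ r → matchAtᵇ γ σ (a + r)) (upTo (suc (suc d)))   ≡⟨ count-two (λ r → matchAtᵇ γ σ (a + r)) d (subst (λ i → matchAtᵇ γ σ i ≡ true) (sym (+-identityʳ a)) match₀) matchd between ⟩
    2                                                          ∎
    where
    open ≡-Reasoning
    in-factor : ∀ r → r < suc (suc d) → r + length γ ≤ m
    in-factor r (s≤s r≤sd) = subst (λ l → r + l ≤ m) (sym len-γ) (+-mono-≤ r≤sd ≤-refl)

sum-cong : {A : Set} (f g : A → ℕ) (L : List A) → (∀ x → x ∈ L → f x ≡ g x) → sum (map f L) ≡ sum (map g L)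
sum-cong f g L eq = cong sum (map-cong-local (tabulate (λ {x} m → eq x m)))

sum-+ : {A : Set} (f g : A → ℕ) (L : List A) → sum (map (λ x → f x + g x) L) ≡ sum (map f L) + sum (map g L)
sum-+ f g [] = refl
sum-+ f g (x ∷ L) = trans (cong (f x + g x +_) (sum-+ f g L)) (regroup (f x) (g x) _ _)
  where
  regroup : ∀ a b c d → a + b + (c + d) ≡ a + c + (b + d)
  regroup = solve-∀

sum-zero : {A : Set} (L : List A) → sum (map (λ _ → 0) L) ≡ 0
sum-zero [] = refl
sum-zero (x ∷ L) = sum-zero L

double-count : {A B : Set} (h : A → B → Bool) (L : List A) (Ms : List B) →
  sum (map (λ x → countᵇ (h x) Ms) L) ≡ sum (map (λ M → countᵇ (λ x → h x M) L) Ms)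
double-count h [] Ms = sym (sum-zero Ms)
double-count h (x ∷ L) Ms = begin
  countᵇ (h x) Ms + sum (map (λ y → countᵇ (h y) Ms) L)                      ≡⟨ cong₂ _+_ (count-sum (h x) Ms) (double-count h L Ms) ⟩
  sum (map (bit ∘ h x) Ms) + sum (map (λ M → countᵇ (λ y → h y M) L) Ms)     ≡⟨ sum-+ (bit ∘ h x) (λ M → countᵇ (λ y → h y M) L) Ms ⟨
  sum (map (λ M → countᵇ (λ y → h y M) (x ∷ L)) Ms)                          ∎
  where open ≡-Reasoning

sublists : List ℕ → List (List ℕ)
sublists [] = [] ∷ []
sublists (x ∷ U) = sublists U ++ map (x ∷_) (sublists U)

even : List ℕ → Bool
even [] = true
even (x ∷ M) = not (even M)

-- the number of subsets of U of the parity selected by r (even: r = id, odd: r = not) on which q holds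
-- everywhere
subsetsWith : (Bool → Bool) → (ℕ → Bool) → List ℕ → ℕ
subsetsWith r q U = countᵇ (λ M → r (even M) ∧ all q M) (sublists U)

subsetsWith-∷ : (r : Bool → Bool) (q : ℕ → Bool) (x : ℕ) (U : List ℕ) →
  subsetsWith r q (x ∷ U) ≡ subsetsWith r q U + (if q x then subsetsWith (r ∘ not) q U else 0)
subsetsWith-∷ r q x U = trans (count-++ _ (sublists U) _) (cong (subsetsWith r q U +_)
  (trans (count-map _ (x ∷_) (sublists U)) (containing-x (q x))))
  where
  containing-x : (b : Bool) → countᵇ (λ M → r (not (even M)) ∧ (b ∧ all q M)) (sublists U) ≡
    (if b then subsetsWith (r ∘ not) q U else 0)
  containing-x true = refl
  containing-x false = count-none _ (sublists U) (λ M _ → ∧-zeroʳ _)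

-- inclusion–exclusion, without signs: among the subsets of U on which q holds everywhere the even
-- ones are one more than the odd ones if q holds nowhere on U, and equally many otherwise
inclusion-exclusion : (q : ℕ → Bool) (U : List ℕ) →
  subsetsWith (λ b → b) q U ≡ bit (countᵇ q U ≡ᵇ 0) + subsetsWith not q U
inclusion-exclusion q [] = refl
inclusion-exclusion q (x ∷ U) rewrite subsetsWith-∷ (λ b → b) q x U | subsetsWith-∷ not q x U with q x
... | false = begin
  subsetsWith (λ b → b) q U + 0                     ≡⟨ +-identityʳ _ ⟩
  subsetsWith (λ b → b) q U                         ≡⟨ inclusion-exclusion q U ⟩
  bit (countᵇ q U ≡ᵇ 0) + subsetsWith not q U       ≡⟨ cong (bit (countᵇ q U ≡ᵇ 0) +_) (+-identityʳ _) ⟨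
  bit (countᵇ q U ≡ᵇ 0) + (subsetsWith not q U + 0) ∎
  where open ≡-Reasoning
... | true = begin
  subsetsWith (λ b → b) q U + subsetsWith not q U   ≡⟨ +-comm (subsetsWith (λ b → b) q U) _ ⟩
  subsetsWith not q U + subsetsWith (λ b → b) q U   ≡⟨ cong (subsetsWith not q U +_) (count-cong _ _ (sublists U) double-not) ⟨
  subsetsWith not q U + subsetsWith (not ∘ not) q U ∎
  where
  open ≡-Reasoning
  double-not : ∀ M → M ∈ sublists U → not (not (even M)) ∧ all q M ≡ even M ∧ all q M
  double-not M _ = cong (_∧ all q M) (not-involutive (even M))

inclusion-exclusion-guarded : (b : Bool) (q : ℕ → Bool) (U : List ℕ) →
  countᵇ (λ M → even M ∧ (b ∧ all q M)) (sublists U) ≡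
  bit ((countᵇ q U ≡ᵇ 0) ∧ b) + countᵇ (λ M → not (even M) ∧ (b ∧ all q M)) (sublists U)
inclusion-exclusion-guarded true q U =
  trans (inclusion-exclusion q U) (cong (λ c → bit c + countᵇ (λ M → not (even M) ∧ all q M) (sublists U)) (sym (∧-identityʳ (countᵇ q U ≡ᵇ 0))))
inclusion-exclusion-guarded false q U = trans (count-none _ (sublists U) (λ M _ → ∧-zeroʳ (even M)))
  (sym (cong₂ (λ c d → bit c + d) (∧-zeroʳ _) (count-none _ (sublists U) (λ M _ → ∧-zeroʳ (not (even M))))))

all⁻ : (p : ℕ → Bool) (M : List ℕ) → all p M ≡ true → ∀ i → i ∈ M → p i ≡ true
all⁻ p (x ∷ M) e i m with p x in px
all⁻ p (x ∷ M) e i (here refl) | true = px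
all⁻ p (x ∷ M) e i (there m) | true = all⁻ p M e i m

all⁺ : (p : ℕ → Bool) (M : List ℕ) → (∀ i → i ∈ M → p i ≡ true) → all p M ≡ true
all⁺ p [] h = refl
all⁺ p (x ∷ M) h rewrite h x (here refl) = all⁺ p M (λ i m → h i (there m))

∈-sublists : (U M : List ℕ) → M ∈ sublists U → ∀ {i} → i ∈ M → i ∈ U
∈-sublists [] .[] (here refl) ()
∈-sublists (x ∷ U) M m i∈ with ∈-++⁻ (sublists U) m
... | inj₁ m′ = there (∈-sublists U M m′ i∈)
... | inj₂ m′ with ∈-map⁻ (x ∷_) m′
...   | M′ , M′∈ , refl with i∈
...     | here e = here e
...     | there i∈′ = there (∈-sublists U M′ M′∈ i∈′)

sublists-increasing : (U : List ℕ) → AllPairs _<_ U → (M : List ℕ) → M ∈ sublists U → AllPairs _<_ M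
sublists-increasing [] _ .[] (here refl) = []
sublists-increasing (x ∷ U) (x< ∷ inc) M m with ∈-++⁻ (sublists U) m
... | inj₁ m′ = sublists-increasing U inc M m′
... | inj₂ m′ with ∈-map⁻ (x ∷_) m′
...   | M′ , M′∈ , refl = tabulate (λ i∈ → lookup x< (∈-sublists U M′ M′∈ i∈)) ∷ sublists-increasing U inc M′ M′∈

positions-increasing : (J n : ℕ) → AllPairs _<_ (positions J n)
positions-increasing J n with J ≤ᵇ n
... | true = applyUpTo⁺₁ (λ i → i) (suc (n ∸ J)) (λ i<j _ → i<j)
... | false = []

positions-fit : (J n i : ℕ) → i ∈ positions J n → i + J ≤ n
positions-fit J n i m with J ≤ᵇ n in J≤n
... | true = subst (i + J ≤_) (m∸n+n≡m (≤ᵇ⇒≤ J n (subst T (sym J≤n) tt))) (+-mono-≤ (s≤s⁻¹ (∈-upTo⁻ m)) ≤-refl)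
  where
  s≤s⁻¹ : ∀ {a b} → suc a ≤ suc b → a ≤ b
  s≤s⁻¹ (s≤s a≤b) = a≤b

spacedᵇ : ℕ → List ℕ → Bool
spacedᵇ k (x ∷ y ∷ M) = (x + k ≤ᵇ y) ∧ spacedᵇ k (y ∷ M)
spacedᵇ k _ = true

spacedᵇ⇒Spaced : (k : ℕ) (M : List ℕ) → spacedᵇ k M ≡ true → Spaced k 0 M
spacedᵇ⇒Spaced k [] _ = tt
spacedᵇ⇒Spaced k (x ∷ M) = from 0 x M z≤n
  where
  from : (off x : ℕ) (M : List ℕ) → off ≤ x → spacedᵇ k (x ∷ M) ≡ true → Spaced k off (x ∷ M)
  from off x [] off≤x _ = off≤x , tt
  from off x (y ∷ M) off≤x e with x + k ≤ᵇ y in x+k≤y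
  ... | true = off≤x , from (x + k) y M (≤ᵇ⇒≤ (x + k) y (subst T (sym x+k≤y) tt)) e

close-pair : (k : ℕ) (M : List ℕ) → AllPairs _<_ M → spacedᵇ k M ≡ false →
  Σ ℕ λ a → Σ ℕ λ D → a ∈ M × a + suc D ∈ M × suc D < k
close-pair k (x ∷ y ∷ M) ((x<y ∷ _) ∷ inc) e with x + k ≤ᵇ y in x+k≤y
... | true with close-pair k (y ∷ M) inc e
...   | a , D , a∈ , b∈ , D<k = a , D , there a∈ , there b∈ , D<k
close-pair k (x ∷ y ∷ M) ((x<y ∷ _) ∷ inc) e | false with m≤n⇒∃[o]m+o≡n x<y
... | D , refl = x , D , here refl , there (here (+-suc x D)) , +-cancelˡ-< x (suc D) k (subst (_< x + k) (sym (+-suc x D)) y<x+k)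
  where
  y<x+k : suc x + D < x + k
  y<x+k = ≰⇒> (λ le → subst T x+k≤y (≤⇒≤ᵇ le))

match⇒red : (k : ℕ) (γ σ : List ℕ) (i : ℕ) → length γ ≡ suc k → matchAtᵇ γ σ i ≡ true → red (take (suc k) (drop i σ)) ≡ γ
match⇒red k γ σ i len e = subst (λ l → red (take l (drop i σ)) ≡ γ) len (toWitness (≡true⇒T e))

red⇒match : (k : ℕ) (γ σ : List ℕ) (i : ℕ) → length γ ≡ suc k → red (take (suc k) (drop i σ)) ≡ γ → matchAtᵇ γ σ i ≡ true
red⇒match k γ σ i len e = T⇒≡true (fromWitness (subst (λ l → red (take l (drop i σ)) ≡ γ) (sym len) e))

module Counting (k : ℕ) (α β : List ℕ) (k≥1 : 1 ≤ k) (α∈ : α ∈ S (suc k)) (β∈ : β ∈ S (suc k))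
  (α₁ : head α ≡ just 1) (β₁ : head β ≡ just 1) (last≡ : last α ≡ last β) (des≡ : des α ≡ des β)
  (mo-α : MinimalOverlapping α) (mo-β : MinimalOverlapping β)
  (P : List ℕ → Bool) (P-inv : ∀ σ τ → des σ ≡ des τ → (inv α ≡ inv β → inv σ ≡ inv τ) → P σ ≡ P τ)
  (n : ℕ) where

  U : List ℕ
  U = positions (suc k) n

  length-α : length α ≡ suc k
  length-α = proj₁ (∈S⁻ (suc k) α α∈)

  length-β : length β ≡ suc k
  length-β = proj₁ (∈S⁻ (suc k) β β∈)

  clustered : List ℕ → List ℕ → ℕ
  clustered γ M = countᵇ (λ σ → P σ ∧ all (matchAtᵇ γ σ) M) (S n)

  -- matches of a minimal overlapping pattern cannot be closer than k
  clustered-unspaced : (γ : List ℕ) → length γ ≡ suc k → MinimalOverlapping γ →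
    (M : List ℕ) → M ∈ sublists U → spacedᵇ k M ≡ false → clustered γ M ≡ 0
  clustered-unspaced γ len mo M M∈ unspaced = count-none _ (S n) (λ σ σ∈ → trans (cong (P σ ∧_) (not-all σ σ∈)) (∧-zeroʳ _))
    where
    not-all : ∀ σ → σ ∈ S n → all (matchAtᵇ γ σ) M ≡ false
    not-all σ σ∈ with all (matchAtᵇ γ σ) M in e
    ... | false = refl
    ... | true with close-pair k M (sublists-increasing U (positions-increasing (suc k) n) M M∈) unspaced
    ...   | a , D , a∈ , b∈ , D<k = ⊥-elim (no-close-matches k γ len mo n σ σ∈ a D D<k
              (positions-fit (suc k) n _ (∈-sublists U M M∈ b∈)) (all⁻ _ M e a a∈) (all⁻ _ M e _ b∈))

  transfer : (γ δ : List ℕ) → length γ ≡ suc k → length δ ≡ suc k → (M : List ℕ) → (f g : List ℕ → List ℕ) →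
    (∀ σ → σ ∈ S n → (∀ i → i ∈ M → red (take (suc k) (drop i σ)) ≡ γ) →
      f σ ∈ S n × (∀ i → i ∈ M → red (take (suc k) (drop i (f σ))) ≡ δ) × g (f σ) ≡ σ ×
      des (f σ) ≡ des σ × (inv α ≡ inv β → inv (f σ) ≡ inv σ)) →
    ∀ σ → σ ∈ S n → P σ ∧ all (matchAtᵇ γ σ) M ≡ true →
    f σ ∈ S n × P (f σ) ∧ all (matchAtᵇ δ (f σ)) M ≡ true × g (f σ) ≡ σ
  transfer γ δ len-γ len-δ M f g swap σ σ∈ e with P σ in Pσ | all (matchAtᵇ γ σ) M in all-γ
  ... | true | true with swap σ σ∈ (λ i i∈ → match⇒red k γ σ i len-γ (all⁻ _ M all-γ i i∈))
  ...   | fσ∈ , fσ-δ , undo , des-eq , inv-eq =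
    fσ∈ ,
    subst (λ b → b ∧ all (matchAtᵇ δ (f σ)) M ≡ true) (sym (trans (P-inv (f σ) σ des-eq inv-eq) Pσ))
      (all⁺ _ M (λ i i∈ → red⇒match k δ (f σ) i len-δ (fσ-δ i i∈))) ,
    undo

  module A = PatternSwap k α β α∈ β∈ k≥1 α₁ β₁ last≡ des≡
  module B = PatternSwap k β α β∈ α∈ k≥1 β₁ α₁ (sym last≡) (sym des≡)

  clustered-equal : (M : List ℕ) → M ∈ sublists U → clustered α M ≡ clustered β M
  clustered-equal M M∈ with spacedᵇ k M in spaced
  ... | false = trans (clustered-unspaced α length-α mo-α M M∈ spaced) (sym (clustered-unspaced β length-β mo-β M M∈ spaced))
  ... | true = count-bijection (S n) (S n) _ _ (A.forward 0 M) (B.forward 0 M) (Unique-S n) (Unique-S n)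
    (transfer α β length-α length-β M (A.forward 0 M) (B.forward 0 M) (λ σ σ∈ → A.swap-word n M σ sp σ∈))
    (transfer β α length-β length-α M (B.forward 0 M) (A.forward 0 M) λ σ σ∈ m →
      let (fσ∈ , fσ-α , undo , des-eq , inv-eq) = B.swap-word n M σ sp σ∈ m in
      fσ∈ , fσ-α , undo , des-eq , λ inv≡ → inv-eq (sym inv≡))
    where
    sp : Spaced k 0 M
    sp = spacedᵇ⇒Spaced k M spaced

  weighted : (Bool → Bool) → List ℕ → ℕ
  weighted r γ = sum (map (λ M → if r (even M) then clustered γ M else 0) (sublists U))

  weighted-equal : (r : Bool → Bool) → weighted r α ≡ weighted r β
  weighted-equal r = sum-cong _ _ (sublists U) (λ M M∈ → cong (if r (even M) then_else 0) (clustered-equal M M∈))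

  subsets-of : (Bool → Bool) → List ℕ → List ℕ → ℕ
  subsets-of r γ σ = countᵇ (λ M → r (even M) ∧ (P σ ∧ all (matchAtᵇ γ σ) M)) (sublists U)

  weighted-by-σ : (r : Bool → Bool) (γ : List ℕ) → weighted r γ ≡ sum (map (subsets-of r γ) (S n))
  weighted-by-σ r γ = trans
    (sum-cong _ _ (sublists U) (λ M _ → sym (count-guard (r (even M)) (λ σ → P σ ∧ all (matchAtᵇ γ σ) M) (S n))))
    (sym (double-count (λ σ M → r (even M) ∧ (P σ ∧ all (matchAtᵇ γ σ) M)) (S n) (sublists U)))

  subsets-of-σ : (γ : List ℕ) → length γ ≡ suc k → (σ : List ℕ) → σ ∈ S n →
    subsets-of (λ b → b) γ σ ≡ bit ((mch γ σ ≡ᵇ 0) ∧ P σ) + subsets-of not γ σ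
  subsets-of-σ γ len σ σ∈ = trans (inclusion-exclusion-guarded (P σ) (matchAtᵇ γ σ) U)
    (cong (λ c → bit (c ∧ P σ) + subsets-of not γ σ)
      (cong₂ (λ l m → countᵇ (matchAtᵇ γ σ) (positions l m) ≡ᵇ 0) (sym len) (sym (proj₁ (∈S⁻ n σ σ∈)))))

  avoiders+odd≡even : (γ : List ℕ) → length γ ≡ suc k → countᵇ P (NM n γ) + weighted not γ ≡ weighted (λ b → b) γ
  avoiders+odd≡even γ len = begin
    countᵇ P (NM n γ) + weighted not γ
      ≡⟨ cong₂ _+_ (trans (count-filter P _ (S n)) (count-sum _ (S n))) (weighted-by-σ not γ) ⟩
    sum (map (λ σ → bit ((mch γ σ ≡ᵇ 0) ∧ P σ)) (S n)) + sum (map (subsets-of not γ) (S n))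
      ≡⟨ sum-+ _ _ (S n) ⟨
    sum (map (λ σ → bit ((mch γ σ ≡ᵇ 0) ∧ P σ) + subsets-of not γ σ) (S n))
      ≡⟨ sum-cong _ _ (S n) (λ σ σ∈ → sym (subsets-of-σ γ len σ σ∈)) ⟩
    sum (map (subsets-of (λ b → b) γ) (S n))
      ≡⟨ weighted-by-σ (λ b → b) γ ⟨
    weighted (λ b → b) γ ∎
    where open ≡-Reasoning

  avoiders-equal : countᵇ P (NM n α) ≡ countᵇ P (NM n β)
  avoiders-equal = +-cancelʳ-≡ (weighted not α) _ _ (begin
    countᵇ P (NM n α) + weighted not α   ≡⟨ avoiders+odd≡even α length-α ⟩
    weighted (λ b → b) α                 ≡⟨ weighted-equal (λ b → b) ⟩
    weighted (λ b → b) β                 ≡⟨ avoiders+odd≡even β length-β ⟨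
    countᵇ P (NM n β) + weighted not β   ≡⟨ cong (countᵇ P (NM n β) +_) (weighted-equal not) ⟨
    countᵇ P (NM n β) + weighted not α   ∎)
    where open ≡-Reasoning

-- Theorem 1.6.  Both statements are instances of Counting.avoiders-equal: for the coefficient of
-- x^d (resp. x^d q^m) take P σ = [des σ = d] (resp. [des σ = d ∧ inv σ = m]).
theorem1p6 : (j : ℕ) (α β : List ℕ) → 3 ≤ j → α ∈ S j → β ∈ S j →
    head α ≡ just 1 → head β ≡ just 1 → last α ≡ last β → des α ≡ des β →
    MinimalOverlapping α → MinimalOverlapping β →
    DesCWilfEquiv α β × (inv α ≡ inv β → DesInvCWilfEquiv α β)
theorem1p6 (suc k@(suc (suc _))) α β (s≤s (s≤s (s≤s _))) α∈ β∈ α₁ β₁ last≡ des≡ mo-α mo-β =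
  (λ n d → avoiders-equal (λ σ → des σ ≡ᵇ d) (λ σ τ des-eq _ → cong (_≡ᵇ d) des-eq) n) ,
  (λ inv≡ n d m → avoiders-equal (λ σ → (des σ ≡ᵇ d) ∧ (inv σ ≡ᵇ m))
    (λ σ τ des-eq inv-eq → cong₂ (λ a b → (a ≡ᵇ d) ∧ (b ≡ᵇ m)) des-eq (inv-eq inv≡)) n)
  where
  avoiders-equal : (P : List ℕ → Bool) → (∀ σ τ → des σ ≡ des τ → (inv α ≡ inv β → inv σ ≡ inv τ) → P σ ≡ P τ) →
    (n : ℕ) → countᵇ P (NM n α) ≡ countᵇ P (NM n β)
  avoiders-equal P P-inv n =
    Counting.avoiders-equal k α β (s≤s z≤n) α∈ β∈ α₁ β₁ last≡ des≡ mo-α mo-β P P-inv n
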